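{- Let $l\in\mathbb{N}$ and let $A\subseteq\mathbb{N}$ be a $J$-set in $(\mathbb{N},+)$. Then the set \[ \{(a,b)\in\mathbb{N}\times\mathbb{N}:\ \{a,a+b,a+2b,\ldots,a+lb\}\subseteq A\} \] is a $J$-set in the semigroup $(\mathbb{N}\times\mathbb{N},+)$ (coordinatewise addition).
   Context: $\mathbb{N}=\{1,2,3,\ldots\}$. For a set $X$, $\mathcal{P}_f(X)$ denotes the set of finite nonempty subsets of $X$, and $S^{\mathbb{N}}$ the set of all sequences (functions) $\mathbb{N}\to S$. For a commutative semigroup $(S,+)$, a set $A\subseteq S$ is a $J$-set if for every $F\in\mathcal{P}_f(S^{\mathbb{N}})$ there exist $a\in S$ and $H\in\mathcal{P}_f(\mathbb{N})$ such that $a+\sum_{t\in H}f(t)\in A$ for every $f\in F$. -}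

module Defs where

open import Data.Nat using (ℕ; zero; suc; _<_)
import Data.Nat as N
open import Data.Product using (_×_; _,_; ∃-syntax)
open import Data.List using (List; []; _∷_)
open import Data.List.NonEmpty using (List⁺; _∷_; toList; foldr₁; map)
open import Data.List.Relation.Unary.All using (All)
open import Data.List.Relation.Unary.Linked using (Linked)
open import Level using (Level; _⊔_)
open import Relation.Unary using (Pred)

-- Positive naturals ℕ = {1,2,3,...}: the element  1+ n  stands for n + 1.
data ℕ₊ : Set where
  1+ : ℕ → ℕ₊

value : ℕ₊ → ℕ
value (1+ n) = suc n

_+₊_ : ℕ₊ → ℕ₊ → ℕ₊
1+ m +₊ 1+ n = 1+ (suc (m N.+ n))

_·₊_ : ℕ₊ → ℕ₊ → ℕ₊
1+ zero ·₊ b = b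
1+ (suc k) ·₊ b = b +₊ (1+ k ·₊ b)

_+²_ : ℕ₊ × ℕ₊ → ℕ₊ × ℕ₊ → ℕ₊ × ℕ₊
(a , b) +² (c , d) = (a +₊ c , b +₊ d)

-- Finite nonempty subsets of ℕ = {1,2,...}: nonempty strictly increasing lists
-- of positive naturals (each such set has exactly one such representation).
record FinSubℕ : Set where
  constructor finSub
  field
    elems      : List⁺ ℕ₊
    increasing : Linked (λ x y → value x < value y) (toList elems)
open FinSubℕ public

sum⁺ : ∀ {a} {S : Set a} → (S → S → S) → (ℕ₊ → S) → List⁺ ℕ₊ → S
sum⁺ _∙_ f ts = foldr₁ _∙_ (map f ts)

IsJSet : ∀ {a ℓ} {S : Set a} → (S → S → S) → Pred S ℓ → Set (a ⊔ ℓ)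
IsJSet {S = S} _∙_ A =
  (F : List⁺ (ℕ₊ → S)) →
  ∃[ x ] ∃[ H ] All (λ f → A (x ∙ sum⁺ _∙_ f (elems H))) (toList F)

-- {(a,b) : {a, a+b, ..., a+l·b} ⊆ A}; note a + 0·b = a.
APSet : ℕ₊ → Pred ℕ₊ Level.zero → Pred (ℕ₊ × ℕ₊) Level.zero
APSet l A (a , b) = A a × (∀ (k : ℕ₊) → value k N.≤ value l → A (a +₊ (k ·₊ b)))

-- Given f = (f₁ , f₂) ∈ F, feed the sequences f₁ + k·(f₂ + 1), k = 0, …, l, to the
-- J-set property of A, obtaining a and H. For x = (a , |H|) we have
-- x + Σ_{t∈H} f(t) = (a + Σ f₁ , |H| + Σ f₂), and the k-th term of the progression it
-- determines is a + Σ_{t∈H} (f₁ t + k·(f₂ t + 1)) ∈ A. The shift f₂ + 1 is what makes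
-- the second coordinate |H| of x a positive natural.
module Submission where

open import Defs
open import Level using (0ℓ)
open import Function using (_∘_)
open import Relation.Unary using (Pred)
open import Data.Nat using (ℕ; zero; suc; _+_; _*_)
open import Data.Nat.Properties using (suc-injective; +-suc; *-identityˡ; *-distribˡ-+)
open import Data.Nat.Tactic.RingSolver using (solve-∀)
open import Data.Product using (_×_; _,_; proj₁; proj₂)
open import Data.List using ([]; _∷_; applyUpTo)
open import Data.List.NonEmpty using (List⁺; _∷_; toList; foldr₁; concatMap)
open import Data.List.NonEmpty.Properties using (map-cong)
open import Data.List.Relation.Unary.All using (All; _∷_)
import Data.List.Relation.Unary.All as All
open import Data.List.Relation.Unary.All.Properties using (applyUpTo⁻; concat⁻; map⁻)
open import Relation.Binary.PropositionalEquality
  using (_≡_; refl; sym; trans; cong; cong₂; subst; module ≡-Reasoning)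

value-injective : ∀ {x y} → value x ≡ value y → x ≡ y
value-injective {1+ m} {1+ n} eq = cong 1+ (suc-injective eq)

value-+₊ : ∀ x y → value (x +₊ y) ≡ value x + value y
value-+₊ (1+ m) (1+ n) = cong suc (sym (+-suc m n))

value-·₊ : ∀ k b → value (k ·₊ b) ≡ value k * value b
value-·₊ (1+ zero)    b = sym (*-identityˡ (value b))
value-·₊ (1+ (suc k)) b = trans (value-+₊ b (1+ k ·₊ b)) (cong (value b +_) (value-·₊ (1+ k) b))

sum⁺-hom : ∀ {a b} {S : Set a} {T : Set b} {_∙_ : S → S → S} {_∘′_ : T → T → T}
           (h : S → T) → (∀ x y → h (x ∙ y) ≡ h x ∘′ h y) →
           ∀ (f : ℕ₊ → S) ts → h (sum⁺ _∙_ f ts) ≡ sum⁺ _∘′_ (h ∘ f) ts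
sum⁺-hom {_∙_ = _∙_} {_∘′_} h h-∙ f (x ∷ xs) = go x xs
  where
  go : ∀ x xs → h (sum⁺ _∙_ f (x ∷ xs)) ≡ sum⁺ _∘′_ (h ∘ f) (x ∷ xs)
  go x []       = refl
  go x (y ∷ ys) = trans (h-∙ (f x) _) (cong (h (f x) ∘′_) (go y ys))

sum⁺-+ : ∀ (u v : ℕ₊ → ℕ) ts →
         sum⁺ _+_ (λ t → u t + v t) ts ≡ sum⁺ _+_ u ts + sum⁺ _+_ v ts
sum⁺-+ u v (x ∷ xs) = go x xs
  where
  interchange : ∀ p q r s → p + q + (r + s) ≡ p + r + (q + s)
  interchange = solve-∀

  go : ∀ x xs → sum⁺ _+_ (λ t → u t + v t) (x ∷ xs) ≡ sum⁺ _+_ u (x ∷ xs) + sum⁺ _+_ v (x ∷ xs)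
  go x []       = refl
  go x (y ∷ ys) = trans (cong (u x + v x +_) (go y ys))
                        (interchange (u x) (v x) (sum⁺ _+_ u (y ∷ ys)) (sum⁺ _+_ v (y ∷ ys)))

sum⁺-* : ∀ k (u : ℕ₊ → ℕ) ts → sum⁺ _+_ (λ t → k * u t) ts ≡ k * sum⁺ _+_ u ts
sum⁺-* k u ts = sym (sum⁺-hom (k *_) (*-distribˡ-+ k) u ts)

sum⁺-cong : ∀ {a} {S : Set a} {_∙_ : S → S → S} {f g : ℕ₊ → S} →
            (∀ t → f t ≡ g t) → ∀ ts → sum⁺ _∙_ f ts ≡ sum⁺ _∙_ g ts
sum⁺-cong {_∙_ = _∙_} f≗g ts = cong (foldr₁ _∙_) (map-cong f≗g ts)

value-sum⁺ : ∀ (g : ℕ₊ → ℕ₊) ts → value (sum⁺ _+₊_ g ts) ≡ sum⁺ _+_ (value ∘ g) ts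
value-sum⁺ = sum⁺-hom value value-+₊

proj₁-sum⁺ : ∀ (f : ℕ₊ → ℕ₊ × ℕ₊) ts → proj₁ (sum⁺ _+²_ f ts) ≡ sum⁺ _+₊_ (proj₁ ∘ f) ts
proj₁-sum⁺ = sum⁺-hom proj₁ (λ _ _ → refl)

value-proj₁-sum⁺ : ∀ (f : ℕ₊ → ℕ₊ × ℕ₊) ts →
                   value (proj₁ (sum⁺ _+²_ f ts)) ≡ sum⁺ _+_ (value ∘ proj₁ ∘ f) ts
value-proj₁-sum⁺ = sum⁺-hom (value ∘ proj₁) (λ p q → value-+₊ (proj₁ p) (proj₁ q))

value-proj₂-sum⁺ : ∀ (f : ℕ₊ → ℕ₊ × ℕ₊) ts →
                   value (proj₂ (sum⁺ _+²_ f ts)) ≡ sum⁺ _+_ (value ∘ proj₂ ∘ f) ts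
value-proj₂-sum⁺ = sum⁺-hom (value ∘ proj₂) (λ p q → value-+₊ (proj₂ p) (proj₂ q))

one : ℕ₊
one = 1+ 0

card : List⁺ ℕ₊ → ℕ₊
card = sum⁺ _+₊_ (λ _ → one)

progressionTerm : (ℕ₊ → ℕ₊ × ℕ₊) → ℕ₊ → ℕ₊ → ℕ₊
progressionTerm f k t = proj₁ (f t) +₊ (k ·₊ (proj₂ (f t) +₊ one))

progressionTerms : ℕ₊ → (ℕ₊ → ℕ₊ × ℕ₊) → List⁺ (ℕ₊ → ℕ₊)
progressionTerms l f = proj₁ ∘ f ∷ applyUpTo (progressionTerm f ∘ 1+) (value l)

value-progressionTerm : ∀ f k t →
  value (progressionTerm f k t) ≡ value (proj₁ (f t)) + value k * (value (proj₂ (f t)) + 1)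
value-progressionTerm f k t = begin
  value (progressionTerm f k t)
    ≡⟨ value-+₊ (proj₁ (f t)) _ ⟩
  value (proj₁ (f t)) + value (k ·₊ (proj₂ (f t) +₊ one))
    ≡⟨ cong (value (proj₁ (f t)) +_) (value-·₊ k _) ⟩
  value (proj₁ (f t)) + value k * value (proj₂ (f t) +₊ one)
    ≡⟨ cong (λ s → value (proj₁ (f t)) + value k * s) (value-+₊ (proj₂ (f t)) one) ⟩
  value (proj₁ (f t)) + value k * (value (proj₂ (f t)) + 1)
    ∎
  where open ≡-Reasoning

value-+₊-·₊ : ∀ a b k c d →
  value ((a +₊ b) +₊ (k ·₊ (c +₊ d))) ≡ value a + value b + value k * (value c + value d)
value-+₊-·₊ a b k c d = trans (value-+₊ (a +₊ b) (k ·₊ (c +₊ d))) (cong₂ _+_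
  (value-+₊ a b)
  (trans (value-·₊ k (c +₊ d)) (cong (value k *_) (value-+₊ c d))))

sum⁺-progressionTerm : ∀ f a k ts →
  a +₊ sum⁺ _+₊_ (progressionTerm f k) ts ≡
  (a +₊ proj₁ (sum⁺ _+²_ f ts)) +₊ (k ·₊ (card ts +₊ proj₂ (sum⁺ _+²_ f ts)))
sum⁺-progressionTerm f a k ts = value-injective (begin
  value (a +₊ sum⁺ _+₊_ (progressionTerm f k) ts)
    ≡⟨ value-+₊ a _ ⟩
  value a + value (sum⁺ _+₊_ (progressionTerm f k) ts)
    ≡⟨ cong (value a +_) (value-sum⁺ (progressionTerm f k) ts) ⟩
  value a + Σ (value ∘ progressionTerm f k)
    ≡⟨ cong (value a +_) (sum⁺-cong (value-progressionTerm f k) ts) ⟩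
  value a + Σ (λ t → f₁ t + value k * (f₂ t + 1))
    ≡⟨ cong (value a +_) (trans (sum⁺-+ f₁ _ ts) (cong (Σ f₁ +_) (sum⁺-* (value k) _ ts))) ⟩
  value a + (Σ f₁ + value k * Σ (λ t → f₂ t + 1))
    ≡⟨ cong (λ s → value a + (Σ f₁ + value k * s)) (sum⁺-+ f₂ (λ _ → 1) ts) ⟩
  value a + (Σ f₁ + value k * (Σ f₂ + Σ (λ _ → 1)))
    ≡⟨ regroup (value a) (Σ f₁) (value k) (Σ f₂) (Σ (λ _ → 1)) ⟩
  value a + Σ f₁ + value k * (Σ (λ _ → 1) + Σ f₂)
    ≡⟨ sym (cong₂ (λ p q → value a + p + value k * q)
                  (value-proj₁-sum⁺ f ts)
                  (cong₂ _+_ (value-sum⁺ (λ _ → one) ts) (value-proj₂-sum⁺ f ts))) ⟩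
  value a + value (proj₁ (sum⁺ _+²_ f ts)) + value k * (value (card ts) + value (proj₂ (sum⁺ _+²_ f ts)))
    ≡⟨ sym (value-+₊-·₊ a _ k (card ts) _) ⟩
  value ((a +₊ proj₁ (sum⁺ _+²_ f ts)) +₊ (k ·₊ (card ts +₊ proj₂ (sum⁺ _+²_ f ts))))
    ∎)
  where
  open ≡-Reasoning
  Σ : (ℕ₊ → ℕ) → ℕ
  Σ u = sum⁺ _+_ u ts
  f₁ f₂ : ℕ₊ → ℕ
  f₁ = value ∘ proj₁ ∘ f
  f₂ = value ∘ proj₂ ∘ f
  regroup : ∀ a b k c n → a + (b + k * (c + n)) ≡ a + b + k * (n + c)
  regroup = solve-∀

APSet-progressionTerms : ∀ l (A : Pred ℕ₊ 0ℓ) f a ts →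
  All (λ g → A (a +₊ sum⁺ _+₊_ g ts)) (toList (progressionTerms l f)) →
  APSet l A ((a , card ts) +² sum⁺ _+²_ f ts)
APSet-progressionTerms l A f a ts (A-first ∷ A-rest) =
  subst A (cong (a +₊_) (sym (proj₁-sum⁺ f ts))) A-first ,
  λ { (1+ j) j<l → subst A (sum⁺-progressionTerm f a (1+ j) ts)
                           (applyUpTo⁻ (progressionTerm f ∘ 1+) (value l) A-rest j<l) }

theorem9 : (l : ℕ₊) (A : Pred ℕ₊ 0ℓ) →
    IsJSet _+₊_ A → IsJSet _+²_ (APSet l A)
-- Matching on F makes toList (concatMap g F) reduce to concat (map toList (map g (toList F))).
theorem9 l A isJ F@(_ ∷ _) with isJ (concatMap (progressionTerms l) F)
... | a , H , A-all =
  (a , card (elems H)) , H ,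
  All.map (APSet-progressionTerms l A _ a (elems H))
          (map⁻ {f = progressionTerms l} (map⁻ {f = toList} (concat⁻ A-all)))
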